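{- Let $s$ be a positive integer and let $k$ and $n$ be square-free positive integers. Then $$\mu(k)\,c_k^{(s)}(n^s)=\mu(n)\,c_n^{(s)}(k^s).$$
   Context: $\mu$ is the Möbius function. For positive integers $a,b$, $(a,b)_s$ denotes the largest $d^s$ ($d\in\mathbb{N}$) with $d^s\mid a$ and $d^s\mid b$. The Cohen–Ramanujan sum is $c_k^{(s)}(n)=\sum_{h=1,\ (h,k^s)_s=1}^{k^s} e^{2\pi i n h/k^s}$. -}

module Defs where

open import Level using (Level)
open import Data.Nat using (ℕ; zero; suc; _≤_)
import Data.Nat as N
open import Data.Nat.Divisibility using (_∣_; _∣?_)
open import Data.Nat.Primality using (Prime; prime?)
open import Data.Bool using (Bool; true; false; if_then_else_)
open import Data.Product using (_×_)
open import Data.Sum using (_⊎_)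
open import Relation.Nullary using (¬_; yes; no; does)
open import Relation.Nullary.Decidable using (_×-dec_)
open import Relation.Binary.PropositionalEquality using (_≡_)
open import Algebra.Bundles using (CommutativeRing)

SquareFree : ℕ → Set
SquareFree n = 1 ≤ n × (∀ d → d N.* d ∣ n → d ≡ 1)

-- Möbius function (as a signed value, encoded in the three cases below):
-- μ(n) = 0 if p² ∣ n for some prime p, otherwise (-1)^(number of primes dividing n).
data Sign : Set where
  pos neg zer : Sign

flip : Sign → Sign
flip pos = neg
flip neg = pos
flip zer = zer

mobiusScan : ℕ → ℕ → Sign
mobiusScan n zero = pos
mobiusScan n (suc p) with does (prime? (suc p)) | does (suc p ∣? n) | does (suc p N.* suc p ∣? n)
... | true | true | true  = zer
... | true | true | false = flip (mobiusScan n p)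
... | _    | _    | _     = mobiusScan n p

μ : ℕ → Sign
μ n = mobiusScan n n

-- (a,b)_s : the largest d^s (d ∈ ℕ, d ≥ 1) with d^s ∣ a and d^s ∣ b.
-- For a ≥ 1 such d satisfies d ≤ a, so we search d = a, a-1, …, 1.
largestBase : ℕ → ℕ → ℕ → ℕ → ℕ
largestBase s a b zero = 1
largestBase s a b (suc d) with does ((suc d N.^ s ∣? a) ×-dec (suc d N.^ s ∣? b))
... | true  = suc d
... | false = largestBase s a b d

gcdₛ : ℕ → ℕ → ℕ → ℕ
gcdₛ s a b = largestBase s a b a N.^ s

module _ {c ℓ : Level} (R : CommutativeRing c ℓ) where
  open CommutativeRing R

  pow : Carrier → ℕ → Carrier
  pow x zero = 1#
  pow x (suc n) = x * pow x n

  signR : Sign → Carrier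
  signR pos = 1#
  signR neg = - 1#
  signR zer = 0#

  cohenPartial : ℕ → ℕ → Carrier → ℕ → ℕ → Carrier
  cohenPartial s m ω N zero = 0#
  cohenPartial s m ω N (suc h) with gcdₛ s (suc h) m N.≟ 1
  ... | yes _ = pow ω (N N.* suc h) + cohenPartial s m ω N h
  ... | no  _ = cohenPartial s m ω N h

  -- Cohen–Ramanujan sum c_k^{(s)}(N) = Σ_{1 ≤ h ≤ k^s, (h,k^s)_s = 1} ω^{N h},
  -- where ω plays the role of e^{2πi/k^s} (a primitive k^s-th root of unity).
  cohenRamanujan : Carrier → ℕ → ℕ → ℕ → Carrier
  cohenRamanujan ω s k N = cohenPartial s (k N.^ s) ω N (k N.^ s)

  PrimitiveRoot : Carrier → ℕ → Set ℓ
  PrimitiveRoot ζ M = pow ζ M ≈ 1# × (∀ j → 0 N.< j → j N.< M → ¬ (pow ζ j ≈ 1#))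

  IsDomain : Set (c Level.⊔ ℓ)
  IsDomain = ¬ (1# ≈ 0#) × (∀ x y → x * y ≈ 0# → x ≈ 0# ⊎ y ≈ 0#)

-- For square-free k and a primitive k^s-th root of unity ω the Cohen–Ramanujan sum factors over
-- the primes dividing k: c_k^{(s)}(N) = ∏_{p ∣ k} c_p^{(s)}(N), where c_p^{(s)}(N) is p^s − 1 if
-- p^s ∣ N and −1 otherwise. Induct on k = p m with p ∤ m: (h, (pm)^s)_s = 1 iff (h, m^s)_s = 1 and
-- p^s ∤ h. Without the condition p^s ∤ h the sum splits into p^s blocks of length m^s, each
-- ω^{N m^s} times the previous one, so it is a geometric sum in ω^{N m^s} (equal to p^s or 0
-- according as p^s ∣ N) times a sum over one block; the excluded h = p^s j contribute
-- c_m^{(s)}(N) for the root ω^{p^s}. Since μ(k) = ∏_{p ∣ k} (−1), this gives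
-- μ(k) c_k^{(s)}(n^s) = ∏_{p ∣ k, p ∣ n} (1 − p^s), which is symmetric in k and n.

module Submission where

open import Defs
open import Level using (Level; _⊔_)
open import Algebra.Bundles using (CommutativeMonoid; CommutativeRing; Semiring)
open import Data.Nat.Base as ℕ using (ℕ; zero; suc; _≤_; s≤s; z≤n)
open import Data.Nat.Properties using (≤-refl; m≤n⇒m≤1+n)
open import Data.Nat.Primality using (Prime)
open import Data.Product using (_×_; _,_; proj₁; proj₂)
open import Function using (_⇔_; mk⇔; Equivalence; _∘_; id)
open import Relation.Nullary using (¬_; yes; no; does)
import Relation.Binary.PropositionalEquality as ≡
open ≡ using (_≡_; _≢_)

module _ where
  open import Data.Nat
  open import Data.Nat.Properties
  open import Data.Nat.Divisibility
  open import Data.Nat.Primality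
  open import Data.Nat.Coprimality using (Coprime; coprime-divisor)
  open import Data.Nat.Primality.Factorisation using (factorise)
  open import Data.Nat.ListAction using (product)
  open import Data.Nat.Induction using (<-rec)
  open import Data.List.Base using ([]; _∷_)
  open import Data.List.Relation.Unary.All using (_∷_)
  open import Data.Bool.Base using (true; false; if_then_else_; _∧_)
  open import Data.Product using (∃-syntax)
  open import Data.Sum using (inj₁; inj₂; [_,_]′)
  open import Data.Empty using (⊥-elim)
  open import Induction.WellFounded using (WfRec)
  open import Relation.Binary.PropositionalEquality
  open import Algebra.Properties.CommutativeSemigroup *-commutativeSemigroup using (interchange)

  ^-distribʳ-* : ∀ a b s → (a * b) ^ s ≡ a ^ s * b ^ s
  ^-distribʳ-* a b zero = refl
  ^-distribʳ-* a b (suc s) rewrite ^-distribʳ-* a b s = interchange a b (a ^ s) (b ^ s)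

  ^-monoˡ-∣ : ∀ {d n} s → d ∣ n → d ^ s ∣ n ^ s
  ^-monoˡ-∣ zero _ = ∣-refl
  ^-monoˡ-∣ (suc s) d∣n = *-pres-∣ d∣n (^-monoˡ-∣ s d∣n)

  prime⇒2≤ : ∀ {p} → Prime p → 2 ≤ p
  prime⇒2≤ {p} pp = nonTrivial⇒n>1 p {{prime⇒nonTrivial pp}}

  prime⇒1≤ : ∀ {p} → Prime p → 1 ≤ p
  prime⇒1≤ pp = ≤-trans (s≤s z≤n) (prime⇒2≤ pp)

  prime∤1 : ∀ {p} → Prime p → ¬ p ∣ 1
  prime∤1 pp p∣1 with ∣1⇒≡1 p∣1 | prime⇒2≤ pp
  ... | refl | s≤s ()

  prime∣^⇒∣ : ∀ {p k} s → Prime p → p ∣ k ^ s → p ∣ k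
  prime∣^⇒∣ zero pp p∣1 = ⊥-elim (prime∤1 pp p∣1)
  prime∣^⇒∣ {k = k} (suc s) pp p∣k^s with euclidsLemma k (k ^ s) pp p∣k^s
  ... | inj₁ p∣k = p∣k
  ... | inj₂ p∣k^s′ = prime∣^⇒∣ s pp p∣k^s′

  p∣p^s : ∀ {p} s → 1 ≤ s → p ∣ p ^ s
  p∣p^s {p} (suc s) _ = m∣m*n (p ^ s)

  prime^∣^⇒∣ : ∀ {p k} s → 1 ≤ s → Prime p → p ^ s ∣ k ^ s → p ∣ k
  prime^∣^⇒∣ s 1≤s pp d = prime∣^⇒∣ s pp (∣-trans (p∣p^s s 1≤s) d)

  prime∣prime⇒≡ : ∀ {q p} → Prime q → Prime p → q ∣ p → q ≡ p
  prime∣prime⇒≡ pq pp q∣p with prime⇒irreducible pp q∣p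
  ... | inj₁ refl = ⊥-elim (prime∤1 pq ∣-refl)
  ... | inj₂ q≡p = q≡p

  ∃prime∣ : ∀ n → 2 ≤ n → ∃[ p ] Prime p × p ∣ n
  ∃prime∣ n@(suc _) 2≤n with factorise n
  ... | record { factors = [] ; isFactorisation = n≡1 } = ⊥-elim (<-irrefl refl (subst (2 ≤_) n≡1 2≤n))
  ... | record { factors = p ∷ ps ; isFactorisation = n≡p*ps ; factorsPrime = pp ∷ _ } =
    p , pp , subst (p ∣_) (sym n≡p*ps) (m∣m*n (product ps))

  noCommonPrime⇒coprime : ∀ {a b} → (∀ r → Prime r → r ∣ a → ¬ r ∣ b) → Coprime a b
  noCommonPrime⇒coprime {a} {b} none {zero} (0∣a , 0∣b)
    rewrite 0∣⇒≡0 0∣a | 0∣⇒≡0 0∣b = ⊥-elim (none 2 prime[2] (2 ∣0) (2 ∣0))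
  noCommonPrime⇒coprime none {1} _ = refl
  noCommonPrime⇒coprime none {i@(suc (suc _))} (i∣a , i∣b) with ∃prime∣ i (s≤s (s≤s z≤n))
  ... | r , pr , r∣i = ⊥-elim (none r pr (∣-trans r∣i i∣a) (∣-trans r∣i i∣b))

  prime^∣prime^*⇒∣ : ∀ {q p x} s → Prime q → Prime p → q ≢ p → q ^ s ∣ p ^ s * x → q ^ s ∣ x
  prime^∣prime^*⇒∣ {q} {p} s pq pp q≢p = coprime-divisor (noCommonPrime⇒coprime common)
    where
    common : ∀ r → Prime r → r ∣ q ^ s → ¬ r ∣ p ^ s
    common r pr r∣q^s r∣p^s = q≢p (trans (sym (prime∣prime⇒≡ pr pq (prime∣^⇒∣ s pr r∣q^s)))
                                          (prime∣prime⇒≡ pr pp (prime∣^⇒∣ s pr r∣p^s)))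

  Coprimeₛ : ℕ → ℕ → ℕ → Set
  Coprimeₛ s h k = ∀ p → Prime p → p ∣ k → ¬ p ^ s ∣ h

  largestBase-∣ : ∀ s a b d → largestBase s a b d ^ s ∣ a × largestBase s a b d ^ s ∣ b
  largestBase-∣ s a b zero rewrite ^-zeroˡ s = 1∣ a , 1∣ b
  largestBase-∣ s a b (suc d) with suc d ^ s ∣? a | suc d ^ s ∣? b
  ... | yes d∣a | yes d∣b = d∣a , d∣b
  ... | yes _   | no _    = largestBase-∣ s a b d
  ... | no _    | _       = largestBase-∣ s a b d

  largestBase≢0 : ∀ s a b d → largestBase s a b d ≢ 0
  largestBase≢0 s a b zero ()
  largestBase≢0 s a b (suc d) with suc d ^ s ∣? a | suc d ^ s ∣? b
  ... | yes _ | yes _ = λ ()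
  ... | yes _ | no _  = largestBase≢0 s a b d
  ... | no _  | _     = largestBase≢0 s a b d

  largestBase-maximal : ∀ s a b d {e} → e ≤ d → e ^ s ∣ a → e ^ s ∣ b → e ≤ largestBase s a b d
  largestBase-maximal s a b zero e≤0 _ _ = ≤-trans e≤0 z≤n
  largestBase-maximal s a b (suc d) {e} e≤1+d e∣a e∣b with suc d ^ s ∣? a | suc d ^ s ∣? b
  ... | yes _ | yes _ = e≤1+d
  ... | yes _ | no ¬∣b =
    largestBase-maximal s a b d (≤-pred (≤∧≢⇒< e≤1+d λ { refl → ¬∣b e∣b })) e∣a e∣b
  ... | no ¬∣a | _ =
    largestBase-maximal s a b d (≤-pred (≤∧≢⇒< e≤1+d λ { refl → ¬∣a e∣a })) e∣a e∣b

  gcdₛ≡1⇔Coprimeₛ : ∀ {s h} k → 1 ≤ s → 1 ≤ h → gcdₛ s h (k ^ s) ≡ 1 ⇔ Coprimeₛ s h k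
  gcdₛ≡1⇔Coprimeₛ {s} {h} k 1≤s 1≤h = mk⇔ to from
    where
    r : ℕ
    r = largestBase s h (k ^ s) h

    to : r ^ s ≡ 1 → Coprimeₛ s h k
    to r^s≡1 p pp p∣k p^s∣h with m^n≡1⇒n≡0∨m≡1 r s r^s≡1
    ... | inj₁ refl = <-irrefl refl 1≤s
    ... | inj₂ r≡1 = <-irrefl refl (≤-trans (prime⇒2≤ pp) (subst (p ≤_) r≡1 p≤r))
      where
      p≤h : p ≤ h
      p≤h = ≤-trans (subst (_≤ p ^ s) (^-identityʳ p) (^-monoʳ-≤ p {{prime⇒nonZero pp}} 1≤s))
                    (∣⇒≤ {{>-nonZero 1≤h}} p^s∣h)
      p≤r : p ≤ r
      p≤r = largestBase-maximal s h (k ^ s) h p≤h p^s∣h (^-monoˡ-∣ s p∣k)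

    from : Coprimeₛ s h k → r ^ s ≡ 1
    from coprime = commonBase^≡1 r (largestBase≢0 s h (k ^ s) h) (largestBase-∣ s h (k ^ s) h)
      where
      commonBase^≡1 : ∀ r → r ≢ 0 → r ^ s ∣ h × r ^ s ∣ k ^ s → r ^ s ≡ 1
      commonBase^≡1 zero r≢0 _ = ⊥-elim (r≢0 refl)
      commonBase^≡1 1 _ _ = ^-zeroˡ s
      commonBase^≡1 r@(suc (suc _)) _ (r^s∣h , r^s∣k^s) with ∃prime∣ r (s≤s (s≤s z≤n))
      ... | q , pq , q∣r =
        ⊥-elim (coprime q pq (prime^∣^⇒∣ s 1≤s pq (∣-trans q^s∣r^s r^s∣k^s)) (∣-trans q^s∣r^s r^s∣h))
        where q^s∣r^s = ^-monoˡ-∣ s q∣r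

  Coprimeₛ-prime* : ∀ {s h p m} → Prime p → Coprimeₛ s h (p * m) ⇔ (Coprimeₛ s h m × ¬ p ^ s ∣ h)
  Coprimeₛ-prime* {s} {h} {p} {m} pp = mk⇔
    (λ coprime → (λ q pq q∣m → coprime q pq (∣n⇒∣m*n p q∣m)) , coprime p pp (m∣m*n m))
    (λ (coprime , p^s∤h) q pq q∣pm →
       [ (λ q∣p → subst (λ q → ¬ q ^ s ∣ h) (sym (prime∣prime⇒≡ pq pp q∣p)) p^s∤h) , coprime q pq ]′
       (euclidsLemma p m pq q∣pm))

  Coprimeₛ-+^ : ∀ {s h} m → Coprimeₛ s (h + m ^ s) m ⇔ Coprimeₛ s h m
  Coprimeₛ-+^ {s} m = mk⇔
    (λ coprime q pq q∣m q^s∣h → coprime q pq q∣m (∣m∣n⇒∣m+n q^s∣h (^-monoˡ-∣ s q∣m)))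
    (λ coprime q pq q∣m q^s∣h+m^s → coprime q pq q∣m
       (∣m+n∣m⇒∣n (subst (q ^ s ∣_) (+-comm _ (m ^ s)) q^s∣h+m^s) (^-monoˡ-∣ s q∣m)))

  Coprimeₛ-prime^* : ∀ {s h p m} → Prime p → ¬ p ∣ m → Coprimeₛ s (p ^ s * h) m ⇔ Coprimeₛ s h m
  Coprimeₛ-prime^* {s} {p = p} pp p∤m = mk⇔
    (λ coprime q pq q∣m q^s∣h → coprime q pq q∣m (∣n⇒∣m*n (p ^ s) q^s∣h))
    (λ coprime q pq q∣m q^s∣p^s*h → coprime q pq q∣m
       (prime^∣prime^*⇒∣ s pq pp (λ { refl → p∤m q∣m }) q^s∣p^s*h))

  SquareFree-prime* : ∀ {p m} → Prime p → SquareFree (p * m) → ¬ p ∣ m × SquareFree m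
  SquareFree-prime* {p} {m} pp (1≤pm , squareFree) = p∤m , 1≤m , λ d d*d∣m → squareFree d (∣n⇒∣m*n p d*d∣m)
    where
    p∤m : ¬ p ∣ m
    p∤m p∣m with squareFree p (*-monoʳ-∣ p p∣m) | prime⇒2≤ pp
    ... | refl | s≤s ()
    1≤m : 1 ≤ m
    1≤m = n≢0⇒n>0 λ { refl → <-irrefl (sym (*-zeroʳ p)) 1≤pm }

  squareFree-induction : ∀ {ℓ} (P : ℕ → Set ℓ) → P 1 →
    (∀ {p m} → Prime p → ¬ p ∣ m → SquareFree m → P m → P (p * m)) →
    ∀ {k} → SquareFree k → P k
  squareFree-induction P P1 step {k} = <-rec (λ k → SquareFree k → P k) go k
    where
    go : ∀ k → WfRec _<_ (λ k → SquareFree k → P k) k → SquareFree k → P k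
    go k rec sfk@(1≤k , _) with k ≟ 1
    ... | yes refl = P1
    ... | no k≢1 with ∃prime∣ k (≤∧≢⇒< 1≤k (k≢1 ∘ sym))
    ... | p , pp , p∣k with SquareFree-prime* pp (subst SquareFree (m∣n⇒n≡m*quotient p∣k) sfk)
    ... | p∤m , sfm = subst P (sym (m∣n⇒n≡m*quotient p∣k)) (step pp p∤m sfm (rec m<k sfm))
      where
      m<k : quotient p∣k < k
      m<k = quotient-< p∣k {{prime⇒nonTrivial pp}} {{>-nonZero 1≤k}}

  mobiusScan-suc : ∀ n p → mobiusScan n (suc p) ≡
    (if does (prime? (suc p)) ∧ does (suc p ∣? n)
     then (if does (suc p * suc p ∣? n) then zer else flip (mobiusScan n p))
     else mobiusScan n p)
  mobiusScan-suc n p with does (prime? (suc p)) | does (suc p ∣? n) | does (suc p * suc p ∣? n)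
  ... | true  | true  | true  = refl
  ... | true  | true  | false = refl
  ... | true  | false | _     = refl
  ... | false | _     | _     = refl

module BigOperator {c ℓ} (M : CommutativeMonoid c ℓ) where
  open CommutativeMonoid M
  open import Algebra.Properties.CommutativeSemigroup commutativeSemigroup using (interchange)

  ⨀ : (ℕ → Carrier) → ℕ → Carrier
  ⨀ f zero = ε
  ⨀ f (suc n) = f (suc n) ∙ ⨀ f n

  ⨀-cong : ∀ {f g} n → (∀ i → 1 ≤ i → i ≤ n → f i ≈ g i) → ⨀ f n ≈ ⨀ g n
  ⨀-cong zero _ = refl
  ⨀-cong (suc n) f≈g =
    ∙-cong (f≈g (suc n) (s≤s z≤n) ≤-refl) (⨀-cong n λ i 1≤i i≤n → f≈g i 1≤i (m≤n⇒m≤1+n i≤n))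

  ⨀-ε : ∀ n → ⨀ (λ _ → ε) n ≈ ε
  ⨀-ε zero = refl
  ⨀-ε (suc n) = trans (identityˡ _) (⨀-ε n)

  ⨀-identity : ∀ {f} n → (∀ i → 1 ≤ i → i ≤ n → f i ≈ ε) → ⨀ f n ≈ ε
  ⨀-identity n f≈ε = trans (⨀-cong n f≈ε) (⨀-ε n)

  ⨀-distrib : ∀ f g n → ⨀ (λ i → f i ∙ g i) n ≈ ⨀ f n ∙ ⨀ g n
  ⨀-distrib f g zero = sym (identityˡ ε)
  ⨀-distrib f g (suc n) = trans (∙-cong refl (⨀-distrib f g n)) (interchange _ _ _ _)

  ⨀-+ : ∀ f m n → ⨀ f (m ℕ.+ n) ≈ ⨀ (λ i → f (i ℕ.+ n)) m ∙ ⨀ f n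
  ⨀-+ f zero n = sym (identityˡ _)
  ⨀-+ f (suc m) n = trans (∙-cong refl (⨀-+ f m n)) (sym (assoc _ _ _))

module _ {c ℓ} (R : CommutativeRing c ℓ) where
  open CommutativeRing R
  open import Relation.Binary.Reasoning.Setoid setoid
  open import Algebra.Definitions.RawSemiring (Semiring.rawSemiring semiring)
    using () renaming (_×_ to _×ᵣ_)
  open import Algebra.Properties.AbelianGroup +-abelianGroup using (⁻¹-anti-homo‿-)
  open import Algebra.Properties.Group +-group using (ε⁻¹≈ε; ⁻¹-involutive; x∙y⁻¹≈ε⇒x≈y; x≈y⇒x∙y⁻¹≈ε)
  open import Algebra.Properties.Ring ring using (-1*x≈-x; [y-z]x≈yx-zx)
  import Algebra.Properties.Semiring.Exp semiring as Exp
  open import Algebra.Solver.Ring.NaturalCoefficients.Default commutativeSemiring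
    using (solve; _:+_; _:*_; _:=_; con)
  open BigOperator +-commutativeMonoid using ()
    renaming (⨀ to ∑; ⨀-cong to ∑-cong; ⨀-identity to ∑-zero; ⨀-+ to ∑-+; ⨀-distrib to ∑-distrib)
  open BigOperator *-commutativeMonoid using ()
    renaming (⨀ to ∏; ⨀-cong to ∏-cong; ⨀-identity to ∏-one; ⨀-+ to ∏-+; ⨀-distrib to ∏-distrib)
  open import Data.Nat.Base using (>-nonZero)
  open import Data.Nat.Properties as ℕₚ using (_≟_; m∸n+n≡m; <⇒≱; +-monoˡ-≤; ≤-pred; ≤∧≢⇒<)
  import Algebra.Properties.CommutativeSemigroup ℕₚ.*-commutativeSemigroup as ℕ*
  open import Data.Nat.DivMod using (_%_; _/_; m≡m%n+[m/n]*n; m%n<n)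
  open import Data.Nat.Divisibility
    using (_∣_; _∣?_; divides; quotient; m∣n⇒n≡m*quotient; *-monoˡ-∣; *-cancelʳ-∣; m%n≡0⇒n∣m; ∣⇒≤;
           m∣m*n; ∣n⇒∣m*n; n∣m*n; ∣-refl; ∣m∣n⇒∣m+n; ∣m+n∣m⇒∣n)
  open import Data.Nat.Primality using (prime?; euclidsLemma; prime⇒nonZero)
  open import Data.Bool.Base using (if_then_else_; _∧_)
  open import Data.Product.Function.NonDependent.Propositional using (_×-⇔_)
  open import Data.Sum using (inj₁; inj₂; [_,_]′)
  open import Data.Empty using (⊥-elim)
  import Function.Properties.Equivalence as ⇔
  open import Relation.Nullary using (Dec)
  open import Relation.Nullary.Decidable using (_×-dec_)

  private
    infixr 8 _^_
    _^_ : Carrier → ℕ → Carrier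
    x ^ n = pow R x n

  x+y≈z⇒x≈z-y : ∀ {x y z} → x + y ≈ z → x ≈ z - y
  x+y≈z⇒x≈z-y {x} {y} {z} x+y≈z = begin
    x            ≈⟨ sym (+-identityʳ x) ⟩
    x + 0#       ≈⟨ +-congˡ (sym (-‿inverseʳ y)) ⟩
    x + (y - y)  ≈⟨ sym (+-assoc x y (- y)) ⟩
    (x + y) - y  ≈⟨ +-congʳ x+y≈z ⟩
    z - y        ∎

  -1*[x-1]≈1-x : ∀ x → - 1# * (x - 1#) ≈ 1# - x
  -1*[x-1]≈1-x x = trans (-1*x≈-x (x - 1#)) (⁻¹-anti-homo‿- x 1#)

  ^≡Exp^ : ∀ x n → x ^ n ≡ x Exp.^ n
  ^≡Exp^ x zero = ≡.refl
  ^≡Exp^ x (suc n) = ≡.cong (x *_) (^≡Exp^ x n)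

  ^-homo-* : ∀ x m n → x ^ (m ℕ.+ n) ≈ x ^ m * x ^ n
  ^-homo-* x m n rewrite ^≡Exp^ x (m ℕ.+ n) | ^≡Exp^ x m | ^≡Exp^ x n = Exp.^-homo-* x m n

  ^-assocʳ : ∀ x m n → (x ^ m) ^ n ≈ x ^ (m ℕ.* n)
  ^-assocʳ x m n rewrite ^≡Exp^ (x ^ m) n | ^≡Exp^ x m | ^≡Exp^ x (m ℕ.* n) = Exp.^-assocʳ x m n

  ^-congˡ : ∀ {x y} n → x ≈ y → x ^ n ≈ y ^ n
  ^-congˡ {x} {y} n x≈y rewrite ^≡Exp^ x n | ^≡Exp^ y n = Exp.^-congˡ n x≈y

  1^≈1 : ∀ n → 1# ^ n ≈ 1#
  1^≈1 zero = refl
  1^≈1 (suc n) = trans (*-identityˡ _) (1^≈1 n)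

  ^≈1-∣ : ∀ {x n j} → x ^ n ≈ 1# → n ∣ j → x ^ j ≈ 1#
  ^≈1-∣ {x} {n} x^n≈1 (divides q ≡.refl) = begin
    x ^ (q ℕ.* n)  ≡⟨ ≡.cong (x ^_) (ℕₚ.*-comm q n) ⟩
    x ^ (n ℕ.* q)  ≈⟨ sym (^-assocʳ x n q) ⟩
    (x ^ n) ^ q    ≈⟨ ^-congˡ q x^n≈1 ⟩
    1# ^ q         ≈⟨ 1^≈1 q ⟩
    1#             ∎

  𝟙 : ∀ {a} {A : Set a} → Dec A → Carrier
  𝟙 (yes _) = 1#
  𝟙 (no _) = 0#

  𝟙-yes : ∀ {a} {A : Set a} → A → (d : Dec A) → 𝟙 d ≈ 1#
  𝟙-yes _ (yes _) = refl
  𝟙-yes a (no ¬a) = ⊥-elim (¬a a)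

  𝟙-no : ∀ {a} {A : Set a} → ¬ A → (d : Dec A) → 𝟙 d ≈ 0#
  𝟙-no ¬a (yes a) = ⊥-elim (¬a a)
  𝟙-no _ (no _) = refl

  𝟙-cong : ∀ {a b} {A : Set a} {B : Set b} → A ⇔ B → (a : Dec A) (b : Dec B) → 𝟙 a ≈ 𝟙 b
  𝟙-cong _ (yes _) (yes _) = refl
  𝟙-cong _ (no _) (no _) = refl
  𝟙-cong A⇔B (yes a) (no ¬b) = ⊥-elim (¬b (Equivalence.to A⇔B a))
  𝟙-cong A⇔B (no ¬a) (yes b) = ⊥-elim (¬a (Equivalence.from A⇔B b))

  𝟙-∧¬ : ∀ {a b c} {A : Set a} {B : Set b} {C : Set c} → C ⇔ (A × ¬ B) →
         (a : Dec A) (b : Dec B) (c : Dec C) → 𝟙 c + 𝟙 b * 𝟙 a ≈ 𝟙 a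
  𝟙-∧¬ C⇔A∧¬B (yes a) (yes b) (yes c) = ⊥-elim (proj₂ (Equivalence.to C⇔A∧¬B c) b)
  𝟙-∧¬ C⇔A∧¬B (yes a) (no ¬b) (no ¬c) = ⊥-elim (¬c (Equivalence.from C⇔A∧¬B (a , ¬b)))
  𝟙-∧¬ C⇔A∧¬B (no ¬a) _ (yes c) = ⊥-elim (¬a (proj₁ (Equivalence.to C⇔A∧¬B c)))
  𝟙-∧¬ _ (yes _) (yes _) (no _) = trans (+-identityˡ _) (*-identityˡ 1#)
  𝟙-∧¬ _ (yes _) (no _) (yes _) = trans (+-congˡ (zeroˡ 1#)) (+-identityʳ 1#)
  𝟙-∧¬ _ (no _) (yes _) (no _) = trans (+-identityˡ _) (zeroʳ 1#)
  𝟙-∧¬ _ (no _) (no _) (no _) = trans (+-identityˡ _) (zeroʳ 0#)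

  infix 9 _when_
  _when_ : ∀ {a} {A : Set a} → Carrier → Dec A → Carrier
  x when yes _ = x
  x when no _ = 1#

  when-yes : ∀ {a} {A : Set a} {x} → A → (d : Dec A) → x when d ≈ x
  when-yes _ (yes _) = refl
  when-yes a (no ¬a) = ⊥-elim (¬a a)

  when-no : ∀ {a} {A : Set a} {x} → ¬ A → (d : Dec A) → x when d ≈ 1#
  when-no ¬a (yes a) = ⊥-elim (¬a a)
  when-no _ (no _) = refl

  when-cong : ∀ {a b} {A : Set a} {B : Set b} {x y} → A ⇔ B → (A → x ≈ y) →
              (a : Dec A) (b : Dec B) → x when a ≈ y when b
  when-cong A⇔B x≈y (yes a) b = trans (x≈y a) (sym (when-yes (Equivalence.to A⇔B a) b))
  when-cong A⇔B x≈y (no ¬a) b = sym (when-no (¬a ∘ Equivalence.from A⇔B) b)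

  when-distrib : ∀ {a} {A : Set a} x y (d : Dec A) → x when d * y when d ≈ (x * y) when d
  when-distrib x y (yes _) = refl
  when-distrib x y (no _) = *-identityˡ 1#

  geometric : Carrier → ℕ → Carrier
  geometric y zero = 0#
  geometric y (suc T) = 1# + y * geometric y T

  geometric-1 : ∀ {y} → y ≈ 1# → ∀ T → geometric y T ≈ T ×ᵣ 1#
  geometric-1 y≈1 zero = refl
  geometric-1 y≈1 (suc T) = +-congˡ (trans (*-cong y≈1 (geometric-1 y≈1 T)) (*-identityˡ _))

  geometric-telescope : ∀ y T → (y - 1#) * geometric y T ≈ y ^ T - 1#
  geometric-telescope y zero = trans (zeroʳ _) (sym (-‿inverseʳ 1#))
  geometric-telescope y (suc T) = begin
    (y - 1#) * (1# + y * geometric y T)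
      ≈⟨ solve 3 (λ y n g → (y :+ n) :* (con 1 :+ y :* g) := (y :+ n) :+ y :* ((y :+ n) :* g))
               refl y (- 1#) (geometric y T) ⟩
    (y - 1#) + y * ((y - 1#) * geometric y T)
      ≈⟨ +-congˡ (*-congˡ (geometric-telescope y T)) ⟩
    (y - 1#) + y * (y ^ T - 1#)
      ≈⟨ solve 3 (λ y n Y → (y :+ n) :+ y :* (Y :+ n) := (y :* Y :+ n) :+ y :* (con 1 :+ n))
               refl y (- 1#) (y ^ T) ⟩
    (y * y ^ T - 1#) + y * (1# - 1#)
      ≈⟨ +-congˡ (trans (*-congˡ (-‿inverseʳ 1#)) (zeroʳ y)) ⟩
    (y * y ^ T - 1#) + 0#
      ≈⟨ +-identityʳ _ ⟩
    y ^ suc T - 1#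
      ∎

  geometric-root : IsDomain R → ∀ {y} T → y ^ T ≈ 1# → ¬ y ≈ 1# → geometric y T ≈ 0#
  geometric-root (_ , noZeroDivisors) {y} T y^T≈1 y≉1
    with noZeroDivisors (y - 1#) (geometric y T) (trans (geometric-telescope y T) (x≈y⇒x∙y⁻¹≈ε y^T≈1))
  ... | inj₁ y-1≈0 = ⊥-elim (y≉1 (x∙y⁻¹≈ε⇒x≈y y 1# y-1≈0))
  ... | inj₂ geometric≈0 = geometric≈0

  ∑-*ˡ : ∀ y f n → y * ∑ f n ≈ ∑ (λ i → y * f i) n
  ∑-*ˡ y f zero = zeroʳ y
  ∑-*ˡ y f (suc n) = trans (distribˡ y _ _) (+-congˡ (∑-*ˡ y f n))

  ∑-periodic : ∀ f y M → (∀ i → 1 ≤ i → f (i ℕ.+ M) ≈ y * f i) →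
               ∀ T → ∑ f (T ℕ.* M) ≈ geometric y T * ∑ f M
  ∑-periodic f y M shift zero = sym (zeroˡ _)
  ∑-periodic f y M shift (suc T) = begin
    ∑ f (M ℕ.+ T ℕ.* M)                   ≡⟨ ≡.cong (∑ f) (ℕₚ.+-comm M (T ℕ.* M)) ⟩
    ∑ f (T ℕ.* M ℕ.+ M)                   ≈⟨ ∑-+ f (T ℕ.* M) M ⟩
    ∑ (λ i → f (i ℕ.+ M)) (T ℕ.* M) + ∑ f M ≈⟨ +-congʳ (∑-cong (T ℕ.* M) λ i 1≤i _ → shift i 1≤i) ⟩
    ∑ (λ i → y * f i) (T ℕ.* M) + ∑ f M    ≈⟨ +-congʳ (sym (∑-*ˡ y f (T ℕ.* M))) ⟩
    y * ∑ f (T ℕ.* M) + ∑ f M              ≈⟨ +-congʳ (*-congˡ (∑-periodic f y M shift T)) ⟩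
    y * (geometric y T * ∑ f M) + ∑ f M    ≈⟨ solve 3 (λ y g S → y :* (g :* S) :+ S := (con 1 :+ y :* g) :* S)
                                                refl y (geometric y T) (∑ f M) ⟩
    geometric y (suc T) * ∑ f M            ∎

  ∑-multiples : ∀ g Q → 1 ≤ Q → ∀ T → ∑ (λ h → 𝟙 (Q ∣? h) * g h) (T ℕ.* Q) ≈ ∑ (λ j → g (Q ℕ.* j)) T
  ∑-multiples g Q 1≤Q zero = refl
  ∑-multiples g Q@(suc u) 1≤Q (suc T) = begin
    ∑ F (Q ℕ.+ T ℕ.* Q)
      ≈⟨ ∑-+ F Q (T ℕ.* Q) ⟩
    (F (Q ℕ.+ T ℕ.* Q) + ∑ (λ i → F (i ℕ.+ T ℕ.* Q)) u) + ∑ F (T ℕ.* Q)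
      ≈⟨ +-cong (+-cong last others) (∑-multiples g Q 1≤Q T) ⟩
    (g (Q ℕ.* suc T) + 0#) + ∑ (λ j → g (Q ℕ.* j)) T
      ≈⟨ +-congʳ (+-identityʳ _) ⟩
    ∑ (λ j → g (Q ℕ.* j)) (suc T)
      ∎
    where
    F : ℕ → Carrier
    F h = 𝟙 (Q ∣? h) * g h
    Q+TQ≡Q*[1+T] : Q ℕ.+ T ℕ.* Q ≡ Q ℕ.* suc T
    Q+TQ≡Q*[1+T] = ≡.trans (≡.cong (Q ℕ.+_) (ℕₚ.*-comm T Q)) (≡.sym (ℕₚ.*-suc Q T))
    last : F (Q ℕ.+ T ℕ.* Q) ≈ g (Q ℕ.* suc T)
    last = trans (*-cong (𝟙-yes (∣m∣n⇒∣m+n ∣-refl (n∣m*n T)) (Q ∣? (Q ℕ.+ T ℕ.* Q)))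
                         (reflexive (≡.cong g Q+TQ≡Q*[1+T])))
                 (*-identityˡ _)
    Q∤i+TQ : ∀ i → 1 ≤ i → i ≤ u → ¬ Q ∣ i ℕ.+ T ℕ.* Q
    Q∤i+TQ i 1≤i i≤u Q∣i+TQ = <⇒≱ (s≤s i≤u)
      (∣⇒≤ {{>-nonZero 1≤i}} (∣m+n∣m⇒∣n (≡.subst (Q ∣_) (ℕₚ.+-comm i (T ℕ.* Q)) Q∣i+TQ) (n∣m*n T)))
    others : ∑ (λ i → F (i ℕ.+ T ℕ.* Q)) u ≈ 0#
    others = ∑-zero u λ i 1≤i i≤u →
      trans (*-congʳ (𝟙-no (Q∤i+TQ i 1≤i i≤u) (Q ∣? (i ℕ.+ T ℕ.* Q)))) (zeroˡ _)

  primitiveRoot⇒∣ : ∀ {ζ M} → 1 ≤ M → PrimitiveRoot R ζ M → ∀ j → ζ ^ j ≈ 1# → M ∣ j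
  primitiveRoot⇒∣ {ζ} {M@(suc _)} _ (ζ^M≈1 , minimal) j ζ^j≈1 with j % M in j%M≡r
  ... | zero = m%n≡0⇒n∣m j M j%M≡r
  ... | suc r = ⊥-elim (minimal (suc r) (s≤s z≤n) (≡.subst (ℕ._< M) j%M≡r (m%n<n j M)) ζ^[1+r]≈1)
    where
    ζ^[1+r]≈1 : ζ ^ suc r ≈ 1#
    ζ^[1+r]≈1 = begin
      ζ ^ suc r                          ≈⟨ sym (*-identityʳ _) ⟩
      ζ ^ suc r * 1#                     ≈⟨ *-congˡ (sym (trans (^-congˡ (j / M) ζ^M≈1) (1^≈1 (j / M)))) ⟩
      ζ ^ suc r * (ζ ^ M) ^ (j / M)      ≈⟨ *-congˡ (^-assocʳ ζ M (j / M)) ⟩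
      ζ ^ suc r * ζ ^ (M ℕ.* (j / M))    ≈⟨ sym (^-homo-* ζ (suc r) _) ⟩
      ζ ^ (suc r ℕ.+ M ℕ.* (j / M))      ≡⟨ ≡.cong (ζ ^_) j≡1+r+M*[j/M] ⟨
      ζ ^ j                              ≈⟨ ζ^j≈1 ⟩
      1#                                 ∎
      where
      j≡1+r+M*[j/M] : j ≡ suc r ℕ.+ M ℕ.* (j / M)
      j≡1+r+M*[j/M] = ≡.trans (m≡m%n+[m/n]*n j M) (≡.cong₂ ℕ._+_ j%M≡r (ℕₚ.*-comm (j / M) M))

  primitiveRoot-^ : ∀ {ζ} X Y → 1 ≤ Y → PrimitiveRoot R ζ (X ℕ.* Y) → PrimitiveRoot R (ζ ^ Y) X
  primitiveRoot-^ {ζ} X Y 1≤Y (ζ^XY≈1 , minimal) =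
    trans (^-assocʳ ζ Y X) (trans (reflexive (≡.cong (ζ ^_) (ℕₚ.*-comm Y X))) ζ^XY≈1) ,
    λ j 0<j j<X ζ^Yj≈1 → minimal (Y ℕ.* j) (ℕₚ.*-mono-≤ 1≤Y 0<j)
      (≡.subst (Y ℕ.* j ℕ.<_) (ℕₚ.*-comm Y X) (ℕₚ.*-monoʳ-< Y {{>-nonZero 1≤Y}} j<X))
      (trans (sym (^-assocʳ ζ Y j)) ζ^Yj≈1)

  geometric-root-∣ : ∀ {ω P M N} → PrimitiveRoot R ω (P ℕ.* M) → P ∣ N →
                     geometric (ω ^ (N ℕ.* M)) P ≈ P ×ᵣ 1#
  geometric-root-∣ {P = P} {M} (ω^PM≈1 , _) P∣N = geometric-1 (^≈1-∣ ω^PM≈1 (*-monoˡ-∣ M P∣N)) P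

  geometric-root-∤ : IsDomain R → ∀ {ω P M N} → 1 ≤ P → 1 ≤ M → PrimitiveRoot R ω (P ℕ.* M) → ¬ P ∣ N →
                     geometric (ω ^ (N ℕ.* M)) P ≈ 0#
  geometric-root-∤ dom {ω} {P} {M} {N} 1≤P 1≤M prim P∤N = geometric-root dom P y^P≈1 y≉1
    where
    y≉1 : ¬ ω ^ (N ℕ.* M) ≈ 1#
    y≉1 y≈1 = P∤N (*-cancelʳ-∣ M {{>-nonZero 1≤M}}
                     (primitiveRoot⇒∣ (ℕₚ.*-mono-≤ 1≤P 1≤M) prim (N ℕ.* M) y≈1))
    y^P≈1 : (ω ^ (N ℕ.* M)) ^ P ≈ 1#
    y^P≈1 = trans (^-assocʳ ω (N ℕ.* M) P)
      (^≈1-∣ (proj₁ prim) (divides N (≡.trans (ℕₚ.*-assoc N M P) (≡.cong (N ℕ.*_) (ℕₚ.*-comm M P)))))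

  primeDivisor? : ∀ k q → Dec (Prime q × q ∣ k)
  primeDivisor? k q = prime? q ×-dec q ∣? k

  ∏ₚ : (ℕ → Carrier) → ℕ → ℕ → Carrier
  ∏ₚ f k = ∏ (λ q → f q when primeDivisor? k q)

  ∏ₚ-distrib : ∀ f g k B → ∏ₚ f k B * ∏ₚ g k B ≈ ∏ₚ (λ q → f q * g q) k B
  ∏ₚ-distrib f g k B = trans (sym (∏-distrib _ _ B))
    (∏-cong B λ q _ _ → when-distrib (f q) (g q) (primeDivisor? k q))

  ∏ₚ-cong : ∀ {f g} k B → (∀ q → Prime q → q ∣ k → f q ≈ g q) → ∏ₚ f k B ≈ ∏ₚ g k B
  ∏ₚ-cong k B f≈g = ∏-cong B λ q _ _ →
    when-cong (mk⇔ id id) (λ (pq , q∣k) → f≈g q pq q∣k) (primeDivisor? k q) (primeDivisor? k q)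

  ∏ₚ-1 : ∀ (f : ℕ → Carrier) B → ∏ₚ f 1 B ≈ 1#
  ∏ₚ-1 f B = ∏-one B λ q _ _ → when-no (λ (pq , q∣1) → prime∤1 pq q∣1) (primeDivisor? 1 q)

  ∏ₚ-extend : ∀ (f : ℕ → Carrier) {k B} → 1 ≤ k → k ≤ B → ∏ₚ f k B ≈ ∏ₚ f k k
  ∏ₚ-extend f {k} {B} 1≤k k≤B = begin
    ∏ₚ f k B
      ≡⟨ ≡.cong (∏ₚ f k) (≡.sym (m∸n+n≡m k≤B)) ⟩
    ∏ₚ f k (B ℕ.∸ k ℕ.+ k)
      ≈⟨ ∏-+ _ (B ℕ.∸ k) k ⟩
    ∏ (λ i → f (i ℕ.+ k) when primeDivisor? k (i ℕ.+ k)) (B ℕ.∸ k) * ∏ₚ f k k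
      ≈⟨ *-congʳ (∏-one (B ℕ.∸ k) beyond) ⟩
    1# * ∏ₚ f k k
      ≈⟨ *-identityˡ _ ⟩
    ∏ₚ f k k
      ∎
    where
    beyond : ∀ i → 1 ≤ i → i ≤ B ℕ.∸ k → f (i ℕ.+ k) when primeDivisor? k (i ℕ.+ k) ≈ 1#
    beyond i 1≤i _ = when-no (λ (_ , i+k∣k) → <⇒≱ (+-monoˡ-≤ k 1≤i) (∣⇒≤ {{>-nonZero 1≤k}} i+k∣k))
                             (primeDivisor? k (i ℕ.+ k))

  ∏-when≟ : ∀ x {p} B → 1 ≤ p → p ≤ B → ∏ (λ q → x when (q ≟ p)) B ≈ x
  ∏-when≟ x zero 1≤p p≤0 = ⊥-elim (<⇒≱ 1≤p p≤0)
  ∏-when≟ x {p} (suc b) 1≤p p≤1+b with suc b ≟ p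
  ... | yes ≡.refl =
    trans (*-congˡ (∏-one b λ q _ q≤b → when-no (λ { ≡.refl → <⇒≱ ≤-refl q≤b }) (q ≟ p))) (*-identityʳ x)
  ... | no 1+b≢p = trans (*-identityˡ _) (∏-when≟ x b 1≤p (≤-pred (≤∧≢⇒< p≤1+b (1+b≢p ∘ ≡.sym))))

  when-primeDivisor-prime* : ∀ (f : ℕ → Carrier) {p m} q → Prime p → ¬ p ∣ m →
    f q when primeDivisor? (p ℕ.* m) q ≈ f p when (q ≟ p) * f q when primeDivisor? m q
  when-primeDivisor-prime* f {p} {m} q pp p∤m with q ≟ p
  ... | yes ≡.refl = trans (when-yes {x = f p} (pp , m∣m*n m) (primeDivisor? (p ℕ.* m) p))
    (sym (trans (*-congˡ (when-no {x = f p} (p∤m ∘ proj₂) (primeDivisor? m p))) (*-identityʳ _)))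
  ... | no q≢p =
    trans (when-cong {x = f q} (mk⇔ to from) (λ _ → refl) (primeDivisor? (p ℕ.* m) q) (primeDivisor? m q))
          (sym (*-identityˡ _))
    where
    to : Prime q × q ∣ p ℕ.* m → Prime q × q ∣ m
    to (pq , q∣pm) =
      pq , [ (λ q∣p → ⊥-elim (q≢p (prime∣prime⇒≡ pq pp q∣p))) , id ]′ (euclidsLemma p m pq q∣pm)
    from : Prime q × q ∣ m → Prime q × q ∣ p ℕ.* m
    from (pq , q∣m) = pq , ∣n⇒∣m*n p q∣m

  ∏ₚ-prime* : ∀ (f : ℕ → Carrier) {p m B} → Prime p → ¬ p ∣ m → p ≤ B →
              ∏ₚ f (p ℕ.* m) B ≈ f p * ∏ₚ f m B
  ∏ₚ-prime* f {p} {m} {B} pp p∤m p≤B = begin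
    ∏ₚ f (p ℕ.* m) B
      ≈⟨ ∏-cong B (λ q _ _ → when-primeDivisor-prime* f q pp p∤m) ⟩
    ∏ (λ q → f p when (q ≟ p) * f q when primeDivisor? m q) B
      ≈⟨ ∏-distrib _ _ B ⟩
    ∏ (λ q → f p when (q ≟ p)) B * ∏ₚ f m B
      ≈⟨ *-congʳ (∏-when≟ (f p) B (prime⇒1≤ pp) p≤B) ⟩
    f p * ∏ₚ f m B
      ∎

  ∏ₚ-swap : ∀ (f : ℕ → Carrier) k n B →
            ∏ₚ (λ q → f q when (q ∣? n)) k B ≈ ∏ₚ (λ q → f q when (q ∣? k)) n B
  ∏ₚ-swap f k n B = ∏-cong B λ q _ _ → swap q
    where
    swap : ∀ q → (f q when (q ∣? n)) when primeDivisor? k q ≈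
                 (f q when (q ∣? k)) when primeDivisor? n q
    swap q with prime? q | q ∣? k | q ∣? n
    ... | yes _ | yes _ | yes _ = refl
    ... | yes _ | yes _ | no _ = refl
    ... | yes _ | no _ | yes _ = refl
    ... | yes _ | no _ | no _ = refl
    ... | no _ | _ | _ = refl

  signR-flip : ∀ x → signR R (flip x) ≈ - 1# * signR R x
  signR-flip pos = sym (*-identityʳ _)
  signR-flip neg = sym (trans (-1*x≈-x (- 1#)) (⁻¹-involutive 1#))
  signR-flip zer = sym (zeroʳ _)

  signR-mobiusScan-suc : ∀ {q n} → SquareFree n →
    (dp : Dec (Prime q)) (dq : Dec (q ∣ n)) (dq² : Dec (q ℕ.* q ∣ n)) → ∀ x →
    signR R (if does dp ∧ does dq then (if does dq² then zer else flip x) else x) ≈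
    (- 1#) when (dp ×-dec dq) * signR R x
  signR-mobiusScan-suc {q} sf (yes pq) (yes _) (yes q²∣n) x =
    ⊥-elim (prime∤1 pq (≡.subst (q ∣_) (proj₂ sf q q²∣n) ∣-refl))
  signR-mobiusScan-suc sf (yes _) (yes _) (no _) x = signR-flip x
  signR-mobiusScan-suc sf (yes _) (no _) _ x = sym (*-identityˡ _)
  signR-mobiusScan-suc sf (no _) _ _ x = sym (*-identityˡ _)

  μ≈∏ₚ : ∀ {n} → SquareFree n → ∀ B → signR R (mobiusScan n B) ≈ ∏ₚ (λ _ → - 1#) n B
  μ≈∏ₚ sf zero = refl
  μ≈∏ₚ {n} sf (suc p) = begin
    signR R (mobiusScan n (suc p))
      ≡⟨ ≡.cong (signR R) (mobiusScan-suc n p) ⟩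
    signR R (if does (prime? (suc p)) ∧ does (suc p ∣? n)
             then (if does (suc p ℕ.* suc p ∣? n) then zer else flip (mobiusScan n p))
             else mobiusScan n p)
      ≈⟨ signR-mobiusScan-suc sf (prime? (suc p)) (suc p ∣? n) (suc p ℕ.* suc p ∣? n) _ ⟩
    (- 1#) when primeDivisor? n (suc p) * signR R (mobiusScan n p)
      ≈⟨ *-congˡ (μ≈∏ₚ sf p) ⟩
    ∏ₚ (λ _ → - 1#) n (suc p)
      ∎

  cohenTerm : ℕ → ℕ → Carrier → ℕ → ℕ → Carrier
  cohenTerm s k ω N h = 𝟙 (gcdₛ s h (k ℕ.^ s) ≟ 1) * ω ^ (N ℕ.* h)

  cohenSum : ℕ → ℕ → Carrier → ℕ → Carrier
  cohenSum s k ω N = ∑ (cohenTerm s k ω N) (k ℕ.^ s)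

  cohenPartial≈∑ : ∀ s k ω N L → cohenPartial R s (k ℕ.^ s) ω N L ≈ ∑ (cohenTerm s k ω N) L
  cohenPartial≈∑ s k ω N zero = refl
  cohenPartial≈∑ s k ω N (suc L) with gcdₛ s (suc L) (k ℕ.^ s) ≟ 1
  ... | yes _ = +-cong (sym (*-identityˡ _)) (cohenPartial≈∑ s k ω N L)
  ... | no _ = trans (cohenPartial≈∑ s k ω N L) (sym (trans (+-congʳ (zeroˡ _)) (+-identityˡ _)))

  𝟙-gcdₛ-cong : ∀ {s h h′} k k′ → 1 ≤ s → 1 ≤ h → 1 ≤ h′ → Coprimeₛ s h k ⇔ Coprimeₛ s h′ k′ →
                𝟙 (gcdₛ s h (k ℕ.^ s) ≟ 1) ≈ 𝟙 (gcdₛ s h′ (k′ ℕ.^ s) ≟ 1)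
  𝟙-gcdₛ-cong {s} {h} {h′} k k′ 1≤s 1≤h 1≤h′ h∼h′ = 𝟙-cong
    (⇔.trans (gcdₛ≡1⇔Coprimeₛ k 1≤s 1≤h) (⇔.trans h∼h′ (⇔.sym (gcdₛ≡1⇔Coprimeₛ k′ 1≤s 1≤h′))))
    (gcdₛ s h (k ℕ.^ s) ≟ 1) (gcdₛ s h′ (k′ ℕ.^ s) ≟ 1)

  cohenTerm-+^ : ∀ {s} m ω N {i} → 1 ≤ s → 1 ≤ i →
    cohenTerm s m ω N (i ℕ.+ m ℕ.^ s) ≈ ω ^ (N ℕ.* m ℕ.^ s) * cohenTerm s m ω N i
  cohenTerm-+^ {s} m ω N {i} 1≤s 1≤i = begin
    𝟙 (gcdₛ s (i ℕ.+ M) M ≟ 1) * ω ^ (N ℕ.* (i ℕ.+ M))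
      ≈⟨ *-cong (𝟙-gcdₛ-cong m m 1≤s (ℕₚ.≤-trans 1≤i (ℕₚ.m≤m+n i M)) 1≤i (Coprimeₛ-+^ {s} m))
                (reflexive (≡.cong (ω ^_) (ℕₚ.*-distribˡ-+ N i M))) ⟩
    𝟙 (gcdₛ s i M ≟ 1) * ω ^ (N ℕ.* i ℕ.+ N ℕ.* M)
      ≈⟨ *-congˡ (^-homo-* ω (N ℕ.* i) (N ℕ.* M)) ⟩
    𝟙 (gcdₛ s i M ≟ 1) * (ω ^ (N ℕ.* i) * ω ^ (N ℕ.* M))
      ≈⟨ solve 3 (λ a x y → a :* (x :* y) := y :* (a :* x)) refl _ _ _ ⟩
    ω ^ (N ℕ.* M) * cohenTerm s m ω N i
      ∎
    where M = m ℕ.^ s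

  cohenTerm-prime* : ∀ {s p} m ω N {h} → 1 ≤ s → Prime p → 1 ≤ h →
    cohenTerm s (p ℕ.* m) ω N h + 𝟙 (p ℕ.^ s ∣? h) * cohenTerm s m ω N h ≈ cohenTerm s m ω N h
  cohenTerm-prime* {s} {p} m ω N {h} 1≤s pp 1≤h = begin
    𝟙 coprime-pm? * x + 𝟙 p^s∣h? * (𝟙 coprime-m? * x)
      ≈⟨ solve 4 (λ c b a x → c :* x :+ b :* (a :* x) := (c :+ b :* a) :* x) refl _ _ _ x ⟩
    (𝟙 coprime-pm? + 𝟙 p^s∣h? * 𝟙 coprime-m?) * x
      ≈⟨ *-congʳ (𝟙-∧¬ split coprime-m? p^s∣h? coprime-pm?) ⟩
    𝟙 coprime-m? * x
      ∎
    where
    x = ω ^ (N ℕ.* h)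
    coprime-m? = gcdₛ s h (m ℕ.^ s) ≟ 1
    p^s∣h? = p ℕ.^ s ∣? h
    coprime-pm? = gcdₛ s h ((p ℕ.* m) ℕ.^ s) ≟ 1
    split : gcdₛ s h ((p ℕ.* m) ℕ.^ s) ≡ 1 ⇔ (gcdₛ s h (m ℕ.^ s) ≡ 1 × ¬ p ℕ.^ s ∣ h)
    split = ⇔.trans (gcdₛ≡1⇔Coprimeₛ (p ℕ.* m) 1≤s 1≤h)
              (⇔.trans (Coprimeₛ-prime* {s} pp) (⇔.sym (gcdₛ≡1⇔Coprimeₛ m 1≤s 1≤h) ×-⇔ ⇔.refl))

  cohenTerm-prime^* : ∀ {s p} m ω N {j} → 1 ≤ s → Prime p → ¬ p ∣ m → 1 ≤ j →
    cohenTerm s m ω N (p ℕ.^ s ℕ.* j) ≈ cohenTerm s m (ω ^ p ℕ.^ s) N j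
  cohenTerm-prime^* {s} {p} m ω N {j} 1≤s pp p∤m 1≤j = *-cong
    (𝟙-gcdₛ-cong m m 1≤s (ℕₚ.*-mono-≤ (ℕₚ.m^n>0 p {{prime⇒nonZero pp}} s) 1≤j) 1≤j (Coprimeₛ-prime^* {s} pp p∤m))
    (trans (reflexive (≡.cong (ω ^_) (ℕ*.x∙yz≈y∙xz N (p ℕ.^ s) j))) (sym (^-assocʳ ω (p ℕ.^ s) (N ℕ.* j))))

  cohenSum-^ : ∀ s m ω a N → cohenSum s m ω (a ℕ.* N) ≈ cohenSum s m (ω ^ a) N
  cohenSum-^ s m ω a N = ∑-cong (m ℕ.^ s) λ h _ _ →
    *-congˡ (trans (reflexive (≡.cong (ω ^_) (ℕₚ.*-assoc a N h))) (sym (^-assocʳ ω a (N ℕ.* h))))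

  cohenSum-prime* : ∀ {s p} m ω N → 1 ≤ s → Prime p → ¬ p ∣ m →
    cohenSum s (p ℕ.* m) ω N + cohenSum s m (ω ^ p ℕ.^ s) N ≈
    geometric (ω ^ (N ℕ.* m ℕ.^ s)) (p ℕ.^ s) * cohenSum s m ω N
  cohenSum-prime* {s} {p} m ω N 1≤s pp p∤m = begin
    ∑ T ((p ℕ.* m) ℕ.^ s) + cohenSum s m (ω ^ P) N
      ≡⟨ ≡.cong (λ K → ∑ T K + cohenSum s m (ω ^ P) N) (^-distribʳ-* p m s) ⟩
    ∑ T (P ℕ.* M) + cohenSum s m (ω ^ P) N
      ≈⟨ +-congˡ (sym multiples) ⟩
    ∑ T (P ℕ.* M) + ∑ (λ h → 𝟙 (P ∣? h) * A h) (P ℕ.* M)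
      ≈⟨ sym (∑-distrib T _ (P ℕ.* M)) ⟩
    ∑ (λ h → T h + 𝟙 (P ∣? h) * A h) (P ℕ.* M)
      ≈⟨ ∑-cong (P ℕ.* M) (λ h 1≤h _ → cohenTerm-prime* m ω N 1≤s pp 1≤h) ⟩
    ∑ A (P ℕ.* M)
      ≈⟨ ∑-periodic A _ M (λ i 1≤i → cohenTerm-+^ m ω N 1≤s 1≤i) P ⟩
    geometric (ω ^ (N ℕ.* M)) P * ∑ A M
      ∎
    where
    P = p ℕ.^ s
    M = m ℕ.^ s
    T = cohenTerm s (p ℕ.* m) ω N
    A = cohenTerm s m ω N
    multiples : ∑ (λ h → 𝟙 (P ∣? h) * A h) (P ℕ.* M) ≈ cohenSum s m (ω ^ P) N
    multiples = begin
      ∑ (λ h → 𝟙 (P ∣? h) * A h) (P ℕ.* M) ≡⟨ ≡.cong (∑ _) (ℕₚ.*-comm P M) ⟩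
      ∑ (λ h → 𝟙 (P ∣? h) * A h) (M ℕ.* P) ≈⟨ ∑-multiples A P (ℕₚ.m^n>0 p {{prime⇒nonZero pp}} s) M ⟩
      ∑ (λ j → A (P ℕ.* j)) M               ≈⟨ ∑-cong M (λ j 1≤j _ → cohenTerm-prime^* m ω N 1≤s pp p∤m 1≤j) ⟩
      cohenSum s m (ω ^ P) N                ∎

  cohenFactor : ℕ → ℕ → ℕ → Carrier
  cohenFactor s N p = 𝟙 (p ℕ.^ s ∣? N) * (p ℕ.^ s) ×ᵣ 1# - 1#

  cohenFactor-prime^* : ∀ {s q p} N → Prime q → Prime p → q ≢ p →
                        cohenFactor s (p ℕ.^ s ℕ.* N) q ≈ cohenFactor s N q
  cohenFactor-prime^* {s} {q} {p} N pq pp q≢p =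
    +-congʳ (*-congʳ (𝟙-cong (mk⇔ (prime^∣prime^*⇒∣ s pq pp q≢p) (∣n⇒∣m*n (p ℕ.^ s)))
                             (q ℕ.^ s ∣? p ℕ.^ s ℕ.* N) (q ℕ.^ s ∣? N)))

  cohenSum-prime-step : IsDomain R → ∀ {s p m ω} → 1 ≤ s → Prime p → ¬ p ∣ m → 1 ≤ m →
    (∀ {ω′} → PrimitiveRoot R ω′ (m ℕ.^ s) → ∀ N → cohenSum s m ω′ N ≈ ∏ₚ (cohenFactor s N) m m) →
    PrimitiveRoot R ω ((p ℕ.* m) ℕ.^ s) → ∀ N →
    cohenSum s (p ℕ.* m) ω N ≈ cohenFactor s N p * ∏ₚ (cohenFactor s N) m m
  cohenSum-prime-step dom {s} {p} {m} {ω} 1≤s pp p∤m 1≤m hyp prim N = begin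
    cohenSum s (p ℕ.* m) ω N
      ≈⟨ x+y≈z⇒x≈z-y (cohenSum-prime* m ω N 1≤s pp p∤m) ⟩
    geometric (ω ^ (N ℕ.* M)) P * cohenSum s m ω N - cohenSum s m (ω ^ P) N
      ≈⟨ +-cong (periodicPart (P ∣? N)) (-‿cong (hyp ω^P-primitive N)) ⟩
    𝟙 (P ∣? N) * P ×ᵣ 1# * Π - Π
      ≈⟨ +-congˡ (-‿cong (sym (*-identityˡ Π))) ⟩
    𝟙 (P ∣? N) * P ×ᵣ 1# * Π - 1# * Π
      ≈⟨ sym ([y-z]x≈yx-zx Π _ 1#) ⟩
    cohenFactor s N p * Π
      ∎
    where
    P = p ℕ.^ s
    M = m ℕ.^ s
    Π = ∏ₚ (cohenFactor s N) m m
    1≤P : 1 ≤ P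
    1≤P = ℕₚ.m^n>0 p {{prime⇒nonZero pp}} s
    primPM : PrimitiveRoot R ω (P ℕ.* M)
    primPM = ≡.subst (PrimitiveRoot R ω) (^-distribʳ-* p m s) prim
    ω^P-primitive : PrimitiveRoot R (ω ^ P) M
    ω^P-primitive = primitiveRoot-^ M P 1≤P (≡.subst (PrimitiveRoot R ω) (ℕₚ.*-comm P M) primPM)

    periodicPart : (d : Dec (P ∣ N)) → geometric (ω ^ (N ℕ.* M)) P * cohenSum s m ω N ≈ 𝟙 d * P ×ᵣ 1# * Π
    periodicPart (no P∤N) = begin
      geometric (ω ^ (N ℕ.* M)) P * cohenSum s m ω N
        ≈⟨ *-congʳ (geometric-root-∤ dom 1≤P (ℕₚ.m^n>0 m {{>-nonZero 1≤m}} s) primPM P∤N) ⟩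
      0# * cohenSum s m ω N
        ≈⟨ zeroˡ _ ⟩
      0#
        ≈⟨ sym (trans (*-congʳ (zeroˡ _)) (zeroˡ Π)) ⟩
      0# * P ×ᵣ 1# * Π
        ∎
    periodicPart (yes P∣N) = begin
      geometric (ω ^ (N ℕ.* M)) P * cohenSum s m ω N
        ≈⟨ *-cong (geometric-root-∣ primPM P∣N) remainingSum ⟩
      P ×ᵣ 1# * Π
        ≈⟨ *-congʳ (sym (*-identityˡ _)) ⟩
      1# * P ×ᵣ 1# * Π
        ∎
      where
      N′ = quotient P∣N
      N≡P*N′ : N ≡ P ℕ.* N′
      N≡P*N′ = m∣n⇒n≡m*quotient P∣N
      remainingSum : cohenSum s m ω N ≈ Π
      remainingSum = begin
        cohenSum s m ω N                   ≡⟨ ≡.cong (cohenSum s m ω) N≡P*N′ ⟩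
        cohenSum s m ω (P ℕ.* N′)          ≈⟨ cohenSum-^ s m ω P N′ ⟩
        cohenSum s m (ω ^ P) N′            ≈⟨ hyp ω^P-primitive N′ ⟩
        ∏ₚ (cohenFactor s N′) m m          ≈⟨ ∏ₚ-cong m m (λ q pq q∣m →
                                                sym (cohenFactor-prime^* {s} N′ pq pp λ { ≡.refl → p∤m q∣m })) ⟩
        ∏ₚ (cohenFactor s (P ℕ.* N′)) m m  ≡⟨ ≡.cong (λ N → ∏ₚ (cohenFactor s N) m m) N≡P*N′ ⟨
        Π                                  ∎

  cohenSum≈∏ₚ : IsDomain R → ∀ {s} → 1 ≤ s → ∀ {k} → SquareFree k → ∀ {ω} → PrimitiveRoot R ω (k ℕ.^ s) →
                ∀ N → cohenSum s k ω N ≈ ∏ₚ (cohenFactor s N) k k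
  cohenSum≈∏ₚ dom {s} 1≤s = squareFree-induction Formula base step
    where
    Formula : ℕ → Set (c ⊔ ℓ)
    Formula k = ∀ {ω} → PrimitiveRoot R ω (k ℕ.^ s) → ∀ N → cohenSum s k ω N ≈ ∏ₚ (cohenFactor s N) k k

    base : Formula 1
    base {ω} (ω^1≈1 , _) N = begin
      cohenSum s 1 ω N
        ≡⟨ ≡.cong (∑ (cohenTerm s 1 ω N)) (ℕₚ.^-zeroˡ s) ⟩
      cohenTerm s 1 ω N 1 + 0#
        ≈⟨ +-identityʳ _ ⟩
      𝟙 (gcdₛ s 1 (1 ℕ.^ s) ≟ 1) * ω ^ (N ℕ.* 1)
        ≈⟨ *-cong (𝟙-yes coprime (gcdₛ s 1 (1 ℕ.^ s) ≟ 1)) (trans (^-congˡ (N ℕ.* 1) ω≈1) (1^≈1 (N ℕ.* 1))) ⟩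
      1# * 1#
        ≈⟨ *-identityˡ 1# ⟩
      1#
        ≈⟨ sym (∏ₚ-1 (cohenFactor s N) 1) ⟩
      ∏ₚ (cohenFactor s N) 1 1
        ∎
      where
      ω≈1 : ω ≈ 1#
      ω≈1 = trans (sym (*-identityʳ ω)) (trans (reflexive (≡.cong (ω ^_) (≡.sym (ℕₚ.^-zeroˡ s)))) ω^1≈1)
      coprime : gcdₛ s 1 (1 ℕ.^ s) ≡ 1
      coprime = Equivalence.from (gcdₛ≡1⇔Coprimeₛ 1 1≤s ≤-refl) λ q pq q∣1 _ → prime∤1 pq q∣1

    step : ∀ {p m} → Prime p → ¬ p ∣ m → SquareFree m → Formula m → Formula (p ℕ.* m)
    step {p} {m} pp p∤m (1≤m , _) hyp {ω} prim N = begin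
      cohenSum s (p ℕ.* m) ω N  ≈⟨ cohenSum-prime-step dom 1≤s pp p∤m 1≤m hyp prim N ⟩
      f p * ∏ₚ f m m            ≈⟨ *-congˡ (sym (∏ₚ-extend f 1≤m (ℕₚ.m≤n*m m p {{prime⇒nonZero pp}}))) ⟩
      f p * ∏ₚ f m (p ℕ.* m)    ≈⟨ sym (∏ₚ-prime* f pp p∤m (ℕₚ.m≤m*n p m {{>-nonZero 1≤m}})) ⟩
      ∏ₚ f (p ℕ.* m) (p ℕ.* m)  ∎
      where
      f = cohenFactor s N

  symmetricFactor : ℕ → ℕ → ℕ → Carrier
  symmetricFactor s n q = (1# - (q ℕ.^ s) ×ᵣ 1#) when (q ∣? n)

  -1*cohenFactor≈symmetricFactor : ∀ {s q} n → 1 ≤ s → Prime q →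
                                   - 1# * cohenFactor s (n ℕ.^ s) q ≈ symmetricFactor s n q
  -1*cohenFactor≈symmetricFactor {s} {q} n 1≤s pq with q ∣? n
  ... | yes q∣n = trans (-1*[x-1]≈1-x _)
    (+-congˡ (-‿cong (trans (*-congʳ (𝟙-yes (^-monoˡ-∣ s q∣n) (q ℕ.^ s ∣? n ℕ.^ s))) (*-identityˡ _))))
  ... | no q∤n = begin
    - 1# * cohenFactor s (n ℕ.^ s) q
      ≈⟨ -1*[x-1]≈1-x _ ⟩
    1# - 𝟙 (q ℕ.^ s ∣? n ℕ.^ s) * (q ℕ.^ s) ×ᵣ 1#
      ≈⟨ +-congˡ (-‿cong (trans (*-congʳ (𝟙-no (q∤n ∘ prime^∣^⇒∣ s 1≤s pq) (q ℕ.^ s ∣? n ℕ.^ s))) (zeroˡ _))) ⟩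
    1# - 0#
      ≈⟨ trans (+-congˡ ε⁻¹≈ε) (+-identityʳ 1#) ⟩
    1#
      ∎

  μ*cohenRamanujan≈∏ₚ : IsDomain R → ∀ {s k n ζ} → 1 ≤ s → SquareFree k → SquareFree n →
    PrimitiveRoot R ζ ((k ℕ.* n) ℕ.^ s) →
    signR R (μ k) * cohenRamanujan R (ζ ^ n ℕ.^ s) s k (n ℕ.^ s) ≈ ∏ₚ (symmetricFactor s n) k k
  μ*cohenRamanujan≈∏ₚ dom {s} {k} {n} {ζ} 1≤s sfk@(1≤k , _) (1≤n , _) prim = begin
    signR R (μ k) * cohenRamanujan R (ζ ^ n ℕ.^ s) s k (n ℕ.^ s)
      ≈⟨ *-cong (μ≈∏ₚ sfk k) (trans (cohenPartial≈∑ s k _ _ (k ℕ.^ s))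
                                    (cohenSum≈∏ₚ dom 1≤s sfk ζ^[n^s]-primitive (n ℕ.^ s))) ⟩
    ∏ₚ (λ _ → - 1#) k k * ∏ₚ (cohenFactor s (n ℕ.^ s)) k k
      ≈⟨ ∏ₚ-distrib _ _ k k ⟩
    ∏ₚ (λ q → - 1# * cohenFactor s (n ℕ.^ s) q) k k
      ≈⟨ ∏ₚ-cong k k (λ q pq _ → -1*cohenFactor≈symmetricFactor n 1≤s pq) ⟩
    ∏ₚ (symmetricFactor s n) k k
      ∎
    where
    ζ^[n^s]-primitive : PrimitiveRoot R (ζ ^ n ℕ.^ s) (k ℕ.^ s)
    ζ^[n^s]-primitive = primitiveRoot-^ (k ℕ.^ s) (n ℕ.^ s) (ℕₚ.m^n>0 n {{>-nonZero 1≤n}} s)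
      (≡.subst (PrimitiveRoot R ζ) (^-distribʳ-* k n s) prim)

open import Data.Nat using (_*_; _^_)
open import Data.Nat.Properties using (m≤m+n; m≤n+m; *-comm)

lemma3p7 : ∀ {c ℓ : Level} (s k n : ℕ) → 1 ≤ s → SquareFree k → SquareFree n →
    (R : CommutativeRing c ℓ) → IsDomain R → (ζ : CommutativeRing.Carrier R) →
    PrimitiveRoot R ζ ((k * n) ^ s) →
    CommutativeRing._≈_ R
      (CommutativeRing._*_ R (signR R (μ k)) (cohenRamanujan R (pow R ζ (n ^ s)) s k (n ^ s)))
      (CommutativeRing._*_ R (signR R (μ n)) (cohenRamanujan R (pow R ζ (k ^ s)) s n (k ^ s)))
lemma3p7 s k n 1≤s sfk@(1≤k , _) sfn@(1≤n , _) R dom ζ prim = begin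
  _                                        ≈⟨ μ*cohenRamanujan≈∏ₚ R dom 1≤s sfk sfn prim ⟩
  ∏ₚ R (symmetricFactor R s n) k k         ≈⟨ sym (∏ₚ-extend R _ 1≤k (m≤m+n k n)) ⟩
  ∏ₚ R (symmetricFactor R s n) k (k ℕ.+ n) ≈⟨ ∏ₚ-swap R _ k n (k ℕ.+ n) ⟩
  ∏ₚ R (symmetricFactor R s k) n (k ℕ.+ n) ≈⟨ ∏ₚ-extend R _ 1≤n (m≤n+m n k) ⟩
  ∏ₚ R (symmetricFactor R s k) n n         ≈⟨ sym (μ*cohenRamanujan≈∏ₚ R dom 1≤s sfn sfk prim′) ⟩
  _                                        ∎
  where
  open CommutativeRing R using (sym; setoid)
  open import Relation.Binary.Reasoning.Setoid setoid
  prim′ : PrimitiveRoot R ζ ((n * k) ^ s)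
  prim′ = ≡.subst (λ m → PrimitiveRoot R ζ (m ^ s)) (*-comm k n) prim
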